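{- Let $p_1,\dots,p_d$ be distinct primes, $N=p_1\cdots p_d$, $M=N^2$, $M_i=M/p_i^2$, $\pi(x)=\sum_{i=1}^d x_iM_i$ for $x\in\mathbb{Z}^d$, $\mathcal{L}_M=p_1^2\mathbb{Z}\times\dots\times p_d^2\mathbb{Z}$, $\Lambda_M=[p_1^2]\times\dots\times[p_d^2]$ and $\Lambda_N=[p_1]\times\dots\times[p_d]$, where $[n]=\{0,\dots,n-1\}$. Let $B=\pi(\Lambda_N)=\{\sum_j c_jM_j: c_j\in\{0,\dots,p_j-1\}\}\subset\mathbb{Z}_M$. Let $S\subset\Lambda_M$ with $|S|=N$. Then $S\oplus\Lambda_N\oplus\mathcal{L}_M=\mathbb{Z}^d$ (equivalently, $\pi(S)\oplus B=\mathbb{Z}_M$) if and only if for every $a,a'\in S$ with $a\ne a'$ there exists $i\in\{1,\dots,d\}$ such that $p_i\parallel a_i-a'_i$.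
   Context: For a prime $p$ and integer $m$, $p\parallel m$ means $p\mid m$ but $p^2\nmid m$. $X\oplus Y\oplus Z=\mathbb{Z}^d$ means every element of $\mathbb{Z}^d$ is uniquely $x+y+z$ with $x\in X,y\in Y,z\in Z$; $A\oplus B=\mathbb{Z}_M$ means every element of $\mathbb{Z}_M$ is uniquely $a+b\bmod M$ with $a\in A,b\in B$. -}

module Defs where

open import Data.Nat as ℕ using (ℕ; _^_)
open import Data.Nat.Primality using (Prime)
open import Data.Integer as ℤ using (ℤ; +_; _+_; _-_; _*_; _≤_; _<_)
open import Data.Integer.Divisibility using (_∣_)
open import Data.Fin using (Fin; _≟_)
open import Data.Vec using (Vec; lookup; zipWith; tabulate; foldr)
open import Data.List using (map; allFin)
open import Data.Nat.ListAction using (product)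
open import Data.Product using (Σ; ∃; ∃-syntax; _×_; _,_)
open import Data.Bool using (if_then_else_)
open import Relation.Nullary using (¬_; ⌊_⌋)
open import Relation.Binary.PropositionalEquality using (_≡_; _≢_)
open import Function.Definitions using (Injective)

Pt : ℕ → Set
Pt d = Vec ℤ d

_⊕ᵥ_ : ∀ {d} → Pt d → Pt d → Pt d
_⊕ᵥ_ = zipWith _+_

Nof : ∀ {d} → (Fin d → ℕ) → ℕ
Nof {d} p = product (map p (allFin d))

Mof : ∀ {d} → (Fin d → ℕ) → ℕ
Mof p = Nof p ^ 2

-- M_i = M / p_i² = ∏_{j ≠ i} p_j²
Mi : ∀ {d} → (Fin d → ℕ) → Fin d → ℕ
Mi {d} p i = product (map (λ j → if ⌊ j ≟ i ⌋ then 1 else p j ^ 2) (allFin d))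

sumℤ : ∀ {d} → Vec ℤ d → ℤ
sumℤ = foldr _ _+_ (+ 0)

π : ∀ {d} → (Fin d → ℕ) → Pt d → ℤ
π p x = sumℤ (tabulate (λ i → lookup x i * + Mi p i))

InΛN : ∀ {d} → (Fin d → ℕ) → Pt d → Set
InΛN p x = ∀ i → (+ 0 ≤ lookup x i) × (lookup x i < + p i)

InΛM : ∀ {d} → (Fin d → ℕ) → Pt d → Set
InΛM p x = ∀ i → (+ 0 ≤ lookup x i) × (lookup x i < + (p i ^ 2))

InLM : ∀ {d} → (Fin d → ℕ) → Pt d → Set
InLM p x = ∀ i → (+ (p i ^ 2)) ∣ lookup x i

_∥_ : ℕ → ℤ → Set
q ∥ m = (+ q ∣ m) × ¬ (+ (q ^ 2) ∣ m)

-- S ⊂ ℤ^d given by an enumeration s : Fin n → Pt d; membership.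
_∈S_ : ∀ {n d} → Pt d → (Fin n → Pt d) → Set
x ∈S s = ∃[ k ] s k ≡ x

TilesZd : ∀ {n d} → (Fin d → ℕ) → (Fin n → Pt d) → Set
TilesZd p s =
  (∀ z → ∃[ a ] ∃[ b ] ∃[ c ] (a ∈S s × InΛN p b × InLM p c × z ≡ a ⊕ᵥ (b ⊕ᵥ c)))
  × (∀ a b c a' b' c' → a ∈S s → InΛN p b → InLM p c
       → a' ∈S s → InΛN p b' → InLM p c'
       → a ⊕ᵥ (b ⊕ᵥ c) ≡ a' ⊕ᵥ (b' ⊕ᵥ c')
       → (a ≡ a') × (b ≡ b') × (c ≡ c'))

_≡[mod_]_ : ℤ → ℕ → ℤ → Set
x ≡[mod m ] y = + m ∣ (x - y)

-- π(S) ⊕ B = ℤ_M, with B = π(Λ_N); elements of ℤ_M represented by integers mod M.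
TilesZM : ∀ {n d} → (Fin d → ℕ) → (Fin n → Pt d) → Set
TilesZM p s =
  (∀ (z : ℤ) → ∃[ a ] ∃[ b ] (a ∈S s × InΛN p b × z ≡[mod Mof p ] (π p a + π p b)))
  × (∀ a b a' b' → a ∈S s → InΛN p b → a' ∈S s → InΛN p b'
       → (π p a + π p b) ≡[mod Mof p ] (π p a' + π p b')
       → (π p a ≡[mod Mof p ] π p a') × (π p b ≡[mod Mof p ] π p b'))

Separated : ∀ {n d} → (Fin d → ℕ) → (Fin n → Pt d) → Set
Separated p s = ∀ k k' → s k ≢ s k' → ∃[ i ] (p i ∥ (lookup (s k) i - lookup (s k') i))

{-# OPTIONS --safe #-}

-- Everything is compared with the packing condition: the translates a + Λ_N (a ∈ S) are
-- pairwise disjoint modulo 𝓛_M. Since M_j ≡ 0 mod p_i² for j ≠ i and p_i ∤ M_i, the kernel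
-- of π modulo M is exactly 𝓛_M, so π identifies ℤ^d/𝓛_M with ℤ_M; as |S × Λ_N| = N² = M,
-- a packing is automatically a tiling, of ℤ^d modulo 𝓛_M as well as of ℤ_M.
-- Separation gives a packing one coordinate at a time: if p ∥ A − A', then A + [p] and
-- A' + [p] are disjoint modulo p². Conversely, in every tiling of ℤ^d by translates of a box
-- [q_1] × ⋯ × [q_d] modulo q_1²ℤ × ⋯ × q_d²ℤ, two distinct tiles are separated. By induction
-- on d: along each line in the first direction the tiles start in a single class modulo q_1;
-- unless q_1 ∥ a_1 − a'_1 one can choose in each class modulo q_1 a class modulo q_1²,
-- containing a_1 and a'_1, and the tiles starting in the chosen classes project to a tiling of
-- ℤ^(d-1) that contains the projections of a and a'.

module Submission where

open import Defs

open import Data.Nat as ℕ using (ℕ; zero; suc; _^_; NonZero; z≤n)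
import Data.Nat.Properties as ℕ
import Data.Nat.Divisibility as ℕ
open import Data.Nat.ListAction using (product)
open import Data.Nat.ListAction.Properties using (∈⇒∣product)
open import Data.Nat.Primality
  using (Prime; euclidsLemma; prime⇒irreducible; prime⇒nonZero; ¬prime[1]; productOfPrimes≢0)
open import Data.Nat.Tactic.RingSolver using () renaming (solve-∀ to ℕ-solve-∀)
open import Data.Integer as ℤ using (ℤ; +_; +[1+_]; -[1+_]; _+_; _-_; _*_; -_; ∣_∣; +≤+; +<+)
import Data.Integer.Properties as ℤ
open import Data.Integer.Divisibility using (_∣_)
import Data.Integer.Divisibility.Signed as ℤˢ
open import Data.Integer.DivMod using (_%ℕ_; _/ℕ_; a≡a%ℕn+[a/ℕn]*n; n%ℕd<d)
open import Data.Integer.Tactic.RingSolver using (solve-∀)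
open import Data.Fin as Fin using (Fin; zero; suc; _≟_; punchIn; punchOut; remQuot; combine)
open import Data.Fin.Properties
  using (punchInᵢ≢i; punchOut-injective; pigeonhole; any?; <⇒≢; fromℕ<-injective;
         toℕ<n; toℕ-injective; combine-remQuot; *↔×)
open import Data.Vec using ([]; _∷_; lookup; replicate; tabulate; zipWith)
open import Data.Vec.Properties
  using (lookup-zipWith; lookup-replicate; ∷-injectiveˡ; ∷-injectiveʳ; zipWith-assoc; zipWith-identityʳ;
         tabulate∘lookup; tabulate-cong; ≡-dec)
open import Data.Vec.Functional using (removeAt)
open import Data.List using ([]; _∷_)
import Data.List as List
import Data.List.Properties as List
open import Data.List.Relation.Unary.Any using (Any; here; there; satisfied)
import Data.List.Relation.Unary.Any.Properties as Any
import Data.List.Relation.Unary.All.Properties as All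
open import Data.List.Membership.Propositional.Properties using (∈-map⁺; ∈-allFin)
open import Data.Bool using (if_then_else_)
open import Data.Product using (∃; ∃₂; ∃-syntax; _×_; _,_; proj₁; proj₂; map; uncurry)
open import Data.Sum using (inj₁; inj₂)
open import Data.Empty using (⊥-elim)
open import Function using (_∘_; _∘′_; id)
open import Function.Definitions using (Injective)
open import Function.Bundles using (_↔_; Inverse; _⇔_; mk⇔)
open import Function.Properties.Inverse using (↔-sym)
open import Function.Properties.Equivalence using () renaming (trans to ⇔-trans)
open import Relation.Nullary using (¬_; Dec; yes; no; ⌊_⌋)
open import Relation.Nullary.Decidable using (map′; _×-dec_; ¬?)
open import Relation.Binary using (IsEquivalence; Setoid)
import Relation.Binary.Reasoning.Setoid as SetoidReasoning
open import Relation.Binary.PropositionalEquality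
  using (_≡_; _≢_; refl; sym; trans; cong; cong₂; subst; subst₂; module ≡-Reasoning)
open import Algebra.Properties.AbelianGroup ℤ.+-0-abelianGroup using (∙-cancelˡ)
open import Algebra.Properties.CommutativeMonoid.Sum ℤ.+-0-commutativeMonoid
  using (sum; sum-remove; ∑-distrib-+; sum-cong-≗)
open import Algebra.Properties.CommutativeMonoid.Sum ℕ.*-1-commutativeMonoid using ()
  renaming (sum to ∏; sum-remove to ∏-remove; ∑-distrib-+ to ∏-distrib-*;
            sum-cong-≗ to ∏-cong; sum-replicate-zero to ∏-replicate-1)

-- Congruences

-- `_≡[mod_]_` of Defs as a record, so that both sides can be inferred from a goal.
record _≡_[mod_] (x y : ℤ) (m : ℕ) : Set where
  constructor wrap
  field unwrap : x ≡[mod m ] y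
open _≡_[mod_] public

infix 4 _≡_[mod_]

module _ {m : ℕ} where

  mod⇒∣ : ∀ {x y} → x ≡ y [mod m ] → + m ℤˢ.∣ x - y
  mod⇒∣ = ℤˢ.∣ᵤ⇒∣ ∘′ unwrap

  ∣⇒mod : ∀ {x y} → + m ℤˢ.∣ x - y → x ≡ y [mod m ]
  ∣⇒mod = wrap ∘′ ℤˢ.∣⇒∣ᵤ

  mod-reflexive : ∀ {x y} → x ≡ y → x ≡ y [mod m ]
  mod-reflexive {x} refl = ∣⇒mod (ℤˢ.divides (+ 0) (ℤ.+-inverseʳ x))

  mod-refl : ∀ {x} → x ≡ x [mod m ]
  mod-refl = mod-reflexive refl

  mod-sym : ∀ {x y} → x ≡ y [mod m ] → y ≡ x [mod m ]
  mod-sym {x} {y} x≡y = ∣⇒mod (subst (+ m ℤˢ.∣_) (negate x y) (ℤˢ.∣m⇒∣-m (mod⇒∣ x≡y)))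
    where
    negate : ∀ x y → - (x - y) ≡ y - x
    negate = solve-∀

  mod-trans : ∀ {x y z} → x ≡ y [mod m ] → y ≡ z [mod m ] → x ≡ z [mod m ]
  mod-trans {x} {y} {z} x≡y y≡z =
    ∣⇒mod (subst (+ m ℤˢ.∣_) (telescope x y z) (ℤˢ.∣m∣n⇒∣m+n (mod⇒∣ x≡y) (mod⇒∣ y≡z)))
    where
    telescope : ∀ x y z → (x - y) + (y - z) ≡ x - z
    telescope = solve-∀

  mod-isEquivalence : IsEquivalence _≡_[mod m ]
  mod-isEquivalence = record { refl = mod-refl ; sym = mod-sym ; trans = mod-trans }

  +-cong-mod : ∀ {x y u v} → x ≡ y [mod m ] → u ≡ v [mod m ] → x + u ≡ y + v [mod m ]
  +-cong-mod {x} {y} {u} {v} x≡y u≡v =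
    ∣⇒mod (subst (+ m ℤˢ.∣_) (regroup x y u v) (ℤˢ.∣m∣n⇒∣m+n (mod⇒∣ x≡y) (mod⇒∣ u≡v)))
    where
    regroup : ∀ x y u v → (x - y) + (u - v) ≡ (x + u) - (y + v)
    regroup = solve-∀

  +-congˡ-mod : ∀ a {x y} → x ≡ y [mod m ] → a + x ≡ a + y [mod m ]
  +-congˡ-mod a = +-cong-mod (mod-refl {a})

  +-congʳ-mod : ∀ a {x y} → x ≡ y [mod m ] → x + a ≡ y + a [mod m ]
  +-congʳ-mod a x≡y = +-cong-mod x≡y (mod-refl {a})

  +-cancelˡ-mod : ∀ a {x y} → a + x ≡ a + y [mod m ] → x ≡ y [mod m ]
  +-cancelˡ-mod a {x} {y} a+x≡a+y = ∣⇒mod (subst (+ m ℤˢ.∣_) (cancel a x y) (mod⇒∣ a+x≡a+y))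
    where
    cancel : ∀ a x y → (a + x) - (a + y) ≡ x - y
    cancel = solve-∀

  +-cancelʳ-mod : ∀ a {x y} → x + a ≡ y + a [mod m ] → x ≡ y [mod m ]
  +-cancelʳ-mod a {x} {y} x+a≡y+a = ∣⇒mod (subst (+ m ℤˢ.∣_) (cancel a x y) (mod⇒∣ x+a≡y+a))
    where
    cancel : ∀ a x y → (x + a) - (y + a) ≡ x - y
    cancel = solve-∀

  +-multiple-mod : ∀ x k → x + k * + m ≡ x [mod m ]
  +-multiple-mod x k = ∣⇒mod (ℤˢ.divides k (difference x k (+ m)))
    where
    difference : ∀ x k m → (x + k * m) - x ≡ k * m
    difference = solve-∀

  private
    residue-unique-≤ : ∀ {x y} → + 0 ℤ.≤ x → y ℤ.< + m → x ℤ.≤ y → x ≡ y [mod m ] → x ≡ y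
    residue-unique-≤ {x} {y} 0≤x y<m x≤y x≡y = ℤ.i-j≡0⇒i≡j x y (ℤ.∣i∣≡0⇒i≡0 ∣x-y∣≡0)
      where
      ∣x-y∣<m : ∣ x - y ∣ ℕ.< m
      ∣x-y∣<m = ℤ.drop‿+<+ (subst (ℤ._< + m) (sym (ℤ.∣-∣-≤ x≤y))
                                  (ℤ.≤-<-trans (ℤ.i-j≤i y x {{ℤ.nonNegative 0≤x}}) y<m))
      ∣x-y∣≡0 : ∣ x - y ∣ ≡ 0
      ∣x-y∣≡0 with ∣ x - y ∣ | unwrap x≡y | ∣x-y∣<m
      ... | zero  | _  | _   = refl
      ... | suc n | m∣ | n<m = ⊥-elim (ℕ.<⇒≱ n<m (ℕ.∣⇒≤ m∣))

  residue-unique : ∀ {x y} → + 0 ℤ.≤ x → x ℤ.< + m → + 0 ℤ.≤ y → y ℤ.< + m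
                 → x ≡ y [mod m ] → x ≡ y
  residue-unique {x} {y} 0≤x x<m 0≤y y<m x≡y with ℤ.≤-total x y
  ... | inj₁ x≤y = residue-unique-≤ 0≤x y<m x≤y x≡y
  ... | inj₂ y≤x = sym (residue-unique-≤ 0≤y x<m y≤x (mod-sym x≡y))

  mod-self : + m ≡ + 0 [mod m ]
  mod-self = ∣⇒mod (ℤˢ.divides (+ 1) (self-difference (+ m)))
    where
    self-difference : ∀ m → m - + 0 ≡ + 1 * m
    self-difference = solve-∀

mod-setoid : ℕ → Setoid _ _
mod-setoid m = record { isEquivalence = mod-isEquivalence {m} }

module ≡-mod-Reasoning (m : ℕ) = SetoidReasoning (mod-setoid m)

mod-weaken : ∀ {m n x y} → m ℕ.∣ n → x ≡ y [mod n ] → x ≡ y [mod m ]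
mod-weaken m∣n x≡y = wrap (ℕ.∣-trans m∣n (unwrap x≡y))

mod²⇒mod : ∀ {q x y} → x ≡ y [mod q ^ 2 ] → x ≡ y [mod q ]
mod²⇒mod {q} = mod-weaken (ℕ.m∣m*n (q ^ 1))

%ℕ-mod : ∀ x m .{{_ : NonZero m}} → x ≡ + (x %ℕ m) [mod m ]
%ℕ-mod x m = begin
  x                                  ≡⟨ a≡a%ℕn+[a/ℕn]*n x m ⟩
  + (x %ℕ m) + (x /ℕ m) * + m        ≈⟨ +-multiple-mod (+ (x %ℕ m)) (x /ℕ m) ⟩
  + (x %ℕ m)                         ∎
  where open ≡-mod-Reasoning m

*-mod : ∀ {m x y} n → x ≡ y [mod m ] → x * + n ≡ y * + n [mod m ℕ.* n ]
*-mod {m} {x} {y} n x≡y with mod⇒∣ x≡y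
... | ℤˢ.divides k x-y≡km = ∣⇒mod (ℤˢ.divides k (begin
  x * + n - y * + n    ≡⟨ distrib x y (+ n) ⟩
  (x - y) * + n        ≡⟨ cong (_* + n) x-y≡km ⟩
  k * + m * + n        ≡⟨ ℤ.*-assoc k (+ m) (+ n) ⟩
  k * (+ m * + n)      ≡⟨ cong (k *_) (ℤ.pos-* m n) ⟨
  k * + (m ℕ.* n)      ∎))
  where
  open ≡-Reasoning
  distrib : ∀ x y n → x * n - y * n ≡ (x - y) * n
  distrib = solve-∀

mod⇒mod²-shift : ∀ {q x y} .{{_ : NonZero q}} → x ≡ y [mod q ]
               → ∃[ k ] x ≡ y + + k * + q [mod q ^ 2 ]
mod⇒mod²-shift {q} {x} {y} x≡y with mod⇒∣ x≡y
... | ℤˢ.divides Q x-y≡Qq = Q %ℕ q , (begin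
  x                      ≡⟨ split x y ⟩
  y + (x - y)            ≡⟨ cong (λ z → y + z) x-y≡Qq ⟩
  y + Q * + q            ≈⟨ +-congˡ-mod y Qq≡kq ⟩
  y + + (Q %ℕ q) * + q   ∎)
  where
  open ≡-mod-Reasoning (q ^ 2)
  split : ∀ x y → x ≡ y + (x - y)
  split = solve-∀
  Qq≡kq : Q * + q ≡ + (Q %ℕ q) * + q [mod q ^ 2 ]
  Qq≡kq = mod-weaken (ℕ.∣-reflexive (cong (q ℕ.*_) (ℕ.*-identityʳ q))) (*-mod q (%ℕ-mod Q q))

mod? : ∀ m x y → Dec (x ≡ y [mod m ])
mod? m x y = map′ wrap unwrap (m ℕ.∣? ∣ x - y ∣)

_⊖ᵥ_ : ∀ {d} → Pt d → Pt d → Pt d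
_⊖ᵥ_ = zipWith _-_

⊕ᵥ-assoc : ∀ {d} (x y z : Pt d) → (x ⊕ᵥ y) ⊕ᵥ z ≡ x ⊕ᵥ (y ⊕ᵥ z)
⊕ᵥ-assoc = zipWith-assoc ℤ.+-assoc

⊕ᵥ-identityʳ : ∀ {d} (x : Pt d) → x ⊕ᵥ replicate d (+ 0) ≡ x
⊕ᵥ-identityʳ = zipWith-identityʳ ℤ.+-identityʳ

⊕ᵥ-⊖ᵥ : ∀ {d} (x y : Pt d) → y ⊕ᵥ (x ⊖ᵥ y) ≡ x
⊕ᵥ-⊖ᵥ []       []       = refl
⊕ᵥ-⊖ᵥ (x ∷ xs) (y ∷ ys) = cong₂ _∷_ (add-difference x y) (⊕ᵥ-⊖ᵥ xs ys)
  where
  add-difference : ∀ x y → y + (x - y) ≡ x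
  add-difference = solve-∀

⊕ᵥ-cancelˡ : ∀ {d} (x : Pt d) {y z} → x ⊕ᵥ y ≡ x ⊕ᵥ z → y ≡ z
⊕ᵥ-cancelˡ []       {[]}     {[]}     _    = refl
⊕ᵥ-cancelˡ (x ∷ xs) {y ∷ ys} {z ∷ zs} same =
  cong₂ _∷_ (∙-cancelˡ x y z (∷-injectiveˡ same)) (⊕ᵥ-cancelˡ xs (∷-injectiveʳ same))

-- Congruence modulo the lattice q₁²ℤ × ⋯ × q_d²ℤ, again a record for the sake of inference.
record _≡_[mod²_] {d} (x y : Pt d) (q : Fin d → ℕ) : Set where
  constructor mod²
  field mod²-at : ∀ i → lookup x i ≡ lookup y i [mod q i ^ 2 ]
open _≡_[mod²_] public

infix 4 _≡_[mod²_]

module _ {d} {q : Fin d → ℕ} where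

  mod²-reflexive : ∀ {x y} → x ≡ y → x ≡ y [mod² q ]
  mod²-reflexive x≡y = mod² (λ i → mod-reflexive (cong (λ v → lookup v i) x≡y))

  mod²-refl : ∀ {x} → x ≡ x [mod² q ]
  mod²-refl = mod²-reflexive refl

  mod²-sym : ∀ {x y} → x ≡ y [mod² q ] → y ≡ x [mod² q ]
  mod²-sym x≡y = mod² (mod-sym ∘ mod²-at x≡y)

  mod²-trans : ∀ {x y z} → x ≡ y [mod² q ] → y ≡ z [mod² q ] → x ≡ z [mod² q ]
  mod²-trans x≡y y≡z = mod² (λ i → mod-trans (mod²-at x≡y i) (mod²-at y≡z i))

  mod²⇒⊖ᵥ∈L : ∀ {x y} → x ≡ y [mod² q ] → InLM q (x ⊖ᵥ y)
  mod²⇒⊖ᵥ∈L {x} {y} x≡y i = subst (+ (q i ^ 2) ∣_) (sym (lookup-zipWith _-_ i x y)) (unwrap (mod²-at x≡y i))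

  ∈L⇒⊕ᵥ-mod² : ∀ {c} → InLM q c → ∀ x → x ⊕ᵥ c ≡ x [mod² q ]
  ∈L⇒⊕ᵥ-mod² {c} c∈L x = mod² coordinate
    where
    coordinate : ∀ i → lookup (x ⊕ᵥ c) i ≡ lookup x i [mod q i ^ 2 ]
    coordinate i = begin
      lookup (x ⊕ᵥ c) i            ≡⟨ lookup-zipWith _+_ i x c ⟩
      lookup x i + lookup c i      ≈⟨ +-congˡ-mod (lookup x i) cᵢ≡0 ⟩
      lookup x i + + 0             ≡⟨ ℤ.+-identityʳ (lookup x i) ⟩
      lookup x i                   ∎
      where
      open ≡-mod-Reasoning (q i ^ 2)
      cᵢ≡0 : lookup c i ≡ + 0 [mod q i ^ 2 ]
      cᵢ≡0 = wrap (subst (+ (q i ^ 2) ∣_) (sym (ℤ.+-identityʳ (lookup c i))) (c∈L i))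

vec-residue-unique : ∀ {d} {m : Fin d → ℕ} {x y : Pt d}
                   → (∀ i → + 0 ℤ.≤ lookup x i × lookup x i ℤ.< + m i)
                   → (∀ i → + 0 ℤ.≤ lookup y i × lookup y i ℤ.< + m i)
                   → (∀ i → lookup x i ≡ lookup y i [mod m i ]) → x ≡ y
vec-residue-unique {x = x} {y} x∈ y∈ x≡y = begin
  x                    ≡⟨ tabulate∘lookup x ⟨
  tabulate (lookup x)  ≡⟨ tabulate-cong xᵢ≡yᵢ ⟩
  tabulate (lookup y)  ≡⟨ tabulate∘lookup y ⟩
  y                    ∎
  where
  open ≡-Reasoning
  xᵢ≡yᵢ : ∀ i → lookup x i ≡ lookup y i
  xᵢ≡yᵢ i = residue-unique (proj₁ (x∈ i)) (proj₂ (x∈ i)) (proj₁ (y∈ i)) (proj₂ (y∈ i)) (x≡y i)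

-- Tilings by boxes

InInterval : ℕ → ℤ → ℤ → Set
InInterval q t x = ∃[ j ] (+ 0 ℤ.≤ j × j ℤ.< + q) × x ≡ t + j [mod q ^ 2 ]

inInterval-zero : ∀ {q t x} .{{_ : NonZero q}} → x ≡ t [mod q ^ 2 ] → InInterval q t x
inInterval-zero {q} {t} x≡t =
  + 0 , (+≤+ z≤n , +<+ (ℕ.>-nonZero⁻¹ q)) , mod-trans x≡t (mod-reflexive (sym (ℤ.+-identityʳ t)))

record IsIntervalTiling (q : ℕ) (A : ℤ → Set) : Set where
  field
    cover  : ∀ x → ∃[ t ] A t × InInterval q t x
    unique : ∀ {t t' x} → A t → A t' → InInterval q t x → InInterval q t' x → t ≡ t' [mod q ^ 2 ]

module IntervalTiling {q : ℕ} .{{_ : NonZero q}} {A : ℤ → Set} (tiling : IsIntervalTiling q A) where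

  open IsIntervalTiling tiling

  next : ∀ {t} → A t → ∃[ t' ] A t' × t' ≡ t + + q [mod q ^ 2 ]
  next {t} At with cover (t + + q)
  ... | t' , At' , (+ zero , _ , t+q≡t'+0) =
    t' , At' , mod-sym (mod-trans t+q≡t'+0 (mod-reflexive (ℤ.+-identityʳ t')))
  ... | _ , _ , (-[1+ _ ] , (() , _) , _)
  ... | t' , At' , (+[1+ n ] , (_ , 1+n<q) , t+q≡t'+1+n) = ⊥-elim (0≢1+n 0≡1+n)
    where
    -- Otherwise the point t + q − 1 lies both in the interval starting at t and in the one starting at t'.
    q' = ℕ.pred q
    drop-one : ∀ a n → a + (+ 1 + n) - + 1 ≡ a + n
    drop-one = solve-∀
    t+q-1≡t+q' : t + + q - + 1 ≡ t + + q' [mod q ^ 2 ]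
    t+q-1≡t+q' = mod-reflexive (trans (cong (λ z → t + z - + 1) (cong +_ (sym (ℕ.suc-pred q))))
                                      (drop-one t (+ q')))
    t+q-1≡t'+n : t + + q - + 1 ≡ t' + + n [mod q ^ 2 ]
    t+q-1≡t'+n = mod-trans (+-congʳ-mod (- + 1) t+q≡t'+1+n) (mod-reflexive (drop-one t' (+ n)))
    t≡t' : t ≡ t' [mod q ^ 2 ]
    t≡t' = unique At At' (+ q' , (+≤+ z≤n , +<+ (subst (q' ℕ.<_) (ℕ.suc-pred q) (ℕ.n<1+n q'))) , t+q-1≡t+q')
                         (+ n , (+≤+ z≤n , ℤ.<-trans (+<+ (ℕ.n<1+n n)) 1+n<q) , t+q-1≡t'+n)
    t'+q≡t'+1+n : t' + + q ≡ t' + + suc n [mod q ^ 2 ]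
    t'+q≡t'+1+n = mod-trans (+-congʳ-mod (+ q) (mod-sym t≡t')) t+q≡t'+1+n
    0≡1+n : + 0 ≡ + suc n
    0≡1+n = residue-unique (+≤+ z≤n) (+<+ (ℕ.>-nonZero⁻¹ q)) (+≤+ z≤n) 1+n<q
              (mod-trans (mod-sym mod-self) (mod²⇒mod (+-cancelˡ-mod t' t'+q≡t'+1+n)))
    0≢1+n : + 0 ≢ + suc n
    0≢1+n ()

  shift : ∀ {t} → A t → ∀ k → ∃[ t' ] A t' × t' ≡ t + + k * + q [mod q ^ 2 ]
  shift {t} At zero = t , At , mod-reflexive (no-shift t (+ q))
    where
    no-shift : ∀ t q → t ≡ t + + 0 * q
    no-shift = solve-∀
  shift {t} At (suc k) =
    let t₁ , At₁ , t₁≡t+kq = shift At k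
        t₂ , At₂ , t₂≡t₁+q = next At₁
    in  t₂ , At₂ , mod-trans t₂≡t₁+q
                     (mod-trans (+-congʳ-mod (+ q) t₁≡t+kq) (mod-reflexive (one-more t (+ k) (+ q))))
    where
    one-more : ∀ t k q → t + k * q + q ≡ t + (+ 1 + k) * q
    one-more = solve-∀

  -- With t' ≡ t + kq + r and 0 ≤ r < q, the interval starting at t + kq contains t'.
  aligned : ∀ {t t'} → A t → A t' → t ≡ t' [mod q ]
  aligned {t} {t'} At At' = via-shift (mod⇒mod²-shift t'≡t+r)
    where
    r = (t' - t) %ℕ q
    t'≡t+r : t' ≡ t + + r [mod q ]
    t'≡t+r = begin
      t'               ≡⟨ split t t' ⟩
      t + (t' - t)     ≈⟨ +-congˡ-mod t (%ℕ-mod (t' - t) q) ⟩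
      t + + r          ∎
      where
      open ≡-mod-Reasoning q
      split : ∀ t t' → t' ≡ t + (t' - t)
      split = solve-∀
    via-shift : ∃[ k ] t' ≡ t + + r + + k * + q [mod q ^ 2 ] → t ≡ t' [mod q ]
    via-shift (k , t'≡t+r+kq) with shift At k
    ... | t₁ , At₁ , t₁≡t+kq = let open ≡-mod-Reasoning q in begin
      t                ≈⟨ +-multiple-mod t (+ k) ⟨
      t + + k * + q    ≈⟨ mod²⇒mod (mod-sym t₁≡t+kq) ⟩
      t₁               ≈⟨ mod²⇒mod (unique At₁ At' (+ r , r-offset , t'≡t₁+r) (inInterval-zero mod-refl)) ⟩
      t'               ∎
      where
      r-offset : + 0 ℤ.≤ + r × + r ℤ.< + q
      r-offset = +≤+ z≤n , +<+ (n%ℕd<d (t' - t) q)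
      t'≡t₁+r : t' ≡ t₁ + + r [mod q ^ 2 ]
      t'≡t₁+r = begin
        t'                      ≈⟨ t'≡t+r+kq ⟩
        t + + r + + k * + q     ≡⟨ swap t (+ r) (+ k * + q) ⟩
        t + + k * + q + + r     ≈⟨ +-congʳ-mod (+ r) (mod-sym t₁≡t+kq) ⟩
        t₁ + + r                ∎
        where
        open ≡-mod-Reasoning (q ^ 2)
        swap : ∀ a b c → a + b + c ≡ a + c + b
        swap = solve-∀

-- For each residue class modulo q, a choice of one residue class modulo q² inside it.
record Section (q : ℕ) : Set where
  field
    rep      : ℤ → ℤ
    rep-mod  : ∀ t → rep t ≡ t [mod q ]
    rep-cong : ∀ {t t'} → t ≡ t' [mod q ] → rep t ≡ rep t' [mod q ^ 2 ]

  IsRep : ℤ → Set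
  IsRep t = t ≡ rep t [mod q ^ 2 ]

  ≡rep⇒isRep : ∀ {s t} → t ≡ rep s [mod q ^ 2 ] → IsRep t
  ≡rep⇒isRep {s} {t} t≡rep-s =
    mod-trans t≡rep-s (rep-cong (mod-trans (mod-sym (rep-mod s)) (mod²⇒mod (mod-sym t≡rep-s))))

  isRep-unique : ∀ {t t'} → IsRep t → IsRep t' → t ≡ t' [mod q ] → t ≡ t' [mod q ^ 2 ]
  isRep-unique t-rep t'-rep t≡t' = mod-trans t-rep (mod-trans (rep-cong t≡t') (mod-sym t'-rep))

residue-section : ∀ {q} .{{_ : NonZero q}} → Section q
residue-section {q} = record
  { rep      = λ t → + (t %ℕ q)
  ; rep-mod  = λ t → mod-sym (%ℕ-mod t q)
  ; rep-cong = λ {t} {t'} t≡t' → mod-reflexive (residue-unique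
      (+≤+ z≤n) (+<+ (n%ℕd<d t q)) (+≤+ z≤n) (+<+ (n%ℕd<d t' q))
      (mod-trans (mod-sym (%ℕ-mod t q)) (mod-trans t≡t' (%ℕ-mod t' q))))
  }

module _ {q : ℕ} (e : Section q) (c : ℤ) where

  open Section e

  private
    patched : ∀ t → Dec (t ≡ c [mod q ]) → ℤ
    patched t (yes _) = c
    patched t (no _)  = rep t

    patched-mod : ∀ t t≡?c → patched t t≡?c ≡ t [mod q ]
    patched-mod t (yes t≡c) = mod-sym t≡c
    patched-mod t (no _)    = rep-mod t

    patched-cong : ∀ {t t'} t≡?c t'≡?c → t ≡ t' [mod q ]
                 → patched t t≡?c ≡ patched t' t'≡?c [mod q ^ 2 ]
    patched-cong (yes _)   (yes _)    _    = mod-refl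
    patched-cong (yes t≡c) (no t'≢c)  t≡t' = ⊥-elim (t'≢c (mod-trans (mod-sym t≡t') t≡c))
    patched-cong (no t≢c)  (yes t'≡c) t≡t' = ⊥-elim (t≢c (mod-trans t≡t' t'≡c))
    patched-cong (no _)    (no _)     t≡t' = rep-cong t≡t'

    patched-≡ : ∀ {t} t≡?c → t ≡ c [mod q ^ 2 ] → t ≡ patched t t≡?c [mod q ^ 2 ]
    patched-≡ (yes _)  t≡c = t≡c
    patched-≡ (no t≢c) t≡c = ⊥-elim (t≢c (mod²⇒mod t≡c))

    patched-≢ : ∀ {t} t≡?c → ¬ t ≡ c [mod q ] → IsRep t → t ≡ patched t t≡?c [mod q ^ 2 ]
    patched-≢ (yes t≡c) t≢c _     = ⊥-elim (t≢c t≡c)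
    patched-≢ (no _)    _   t-rep = t-rep

  patch : Section q
  patch = record
    { rep      = λ t → patched t (mod? q t c)
    ; rep-mod  = λ t → patched-mod t (mod? q t c)
    ; rep-cong = λ {t} {t'} → patched-cong (mod? q t c) (mod? q t' c)
    }

  patch-≡ : ∀ {t} → t ≡ c [mod q ^ 2 ] → Section.IsRep patch t
  patch-≡ {t} = patched-≡ (mod? q t c)

  patch-≢ : ∀ {t} → ¬ t ≡ c [mod q ] → IsRep t → Section.IsRep patch t
  patch-≢ {t} = patched-≢ (mod? q t c)

section-through : ∀ {q} .{{_ : NonZero q}} a b → (a ≡ b [mod q ] → a ≡ b [mod q ^ 2 ])
                → ∃[ e ] Section.IsRep e a × Section.IsRep e b
section-through {q} a b lift = e , a-rep (mod? q a b) , patch-≡ e₀ b mod-refl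
  where
  e₀ = patch residue-section a
  e  = patch e₀ b
  a-rep : Dec (a ≡ b [mod q ]) → Section.IsRep e a
  a-rep (yes a≡b) = patch-≡ e₀ b (lift a≡b)
  a-rep (no a≢b)  = patch-≢ e₀ b a≢b (patch-≡ residue-section a mod-refl)

InBox : ∀ {d} → (Fin d → ℕ) → Pt d → Pt d → Set
InBox q a x = ∃[ b ] InΛN q b × x ≡ a ⊕ᵥ b [mod² q ]

record IsBoxTiling {d} (q : Fin d → ℕ) (T : Pt d → Set) : Set where
  field
    cover  : ∀ x → ∃[ a ] T a × InBox q a x
    unique : ∀ {a a' x} → T a → T a' → InBox q a x → InBox q a' x → a ≡ a' [mod² q ]

module _ {d} {q : Fin (suc d) → ℕ} {t x : ℤ} {a y : Pt d} where

  inBox-∷⁺ : InInterval (q zero) t x → InBox (q ∘ suc) a y → InBox q (t ∷ a) (x ∷ y)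
  inBox-∷⁺ (j , j∈ , x≡t+j) (b , b∈ , y≡a+b) =
    j ∷ b , (λ { zero → j∈ ; (suc i) → b∈ i }) , mod² (λ { zero → x≡t+j ; (suc i) → mod²-at y≡a+b i })

  inBox-∷⁻ : InBox q (t ∷ a) (x ∷ y) → InInterval (q zero) t x × InBox (q ∘ suc) a y
  inBox-∷⁻ (j ∷ b , j∷b∈ , x∷y≡) =
    (j , j∷b∈ zero , mod²-at x∷y≡ zero) , (b , j∷b∈ ∘ suc , mod² (mod²-at x∷y≡ ∘ suc))

inBox-zero : ∀ {d} {q : Fin d → ℕ} → (∀ i → NonZero (q i)) → ∀ {a x} → x ≡ a [mod² q ] → InBox q a x
inBox-zero {d} {q} q≢0 {a} {x} x≡a = replicate d (+ 0) , zero∈Λ , x≡a+0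
  where
  zero∈Λ : InΛN q (replicate d (+ 0))
  zero∈Λ i rewrite lookup-replicate i (+ 0) = +≤+ z≤n , +<+ (ℕ.>-nonZero⁻¹ (q i) {{q≢0 i}})
  x≡a+0 : x ≡ a ⊕ᵥ replicate d (+ 0) [mod² q ]
  x≡a+0 = subst (x ≡_[mod² q ]) (sym (⊕ᵥ-identityʳ a)) x≡a

isBoxTiling⇒nonZero : ∀ {d} {q : Fin d → ℕ} {T} → IsBoxTiling q T → ∀ i → NonZero (q i)
isBoxTiling⇒nonZero {d} tiling i =
  let _ , _ , b , b∈Λ , _ = IsBoxTiling.cover tiling (replicate d (+ 0))
  in  ℕ.>-nonZero (ℤ.drop‿+<+ (ℤ.≤-<-trans (proj₁ (b∈Λ i)) (proj₂ (b∈Λ i))))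

Column : ∀ {d} → (Fin (suc d) → ℕ) → (Pt (suc d) → Set) → Pt d → ℤ → Set
Column q T y t = ∃[ a ] T (t ∷ a) × InBox (q ∘ suc) a y

Slice : ∀ {d} (q : Fin (suc d) → ℕ) → (Pt (suc d) → Set) → Section (q zero) → Pt d → Set
Slice q T e y = ∃[ t ] Section.IsRep e t × T (t ∷ y)

module BoxTilingStep {d} {q : Fin (suc d) → ℕ} {T : Pt (suc d) → Set} (tiling : IsBoxTiling q T) where

  open IsBoxTiling tiling

  instance
    q₀≢0 : NonZero (q zero)
    q₀≢0 = isBoxTiling⇒nonZero tiling zero

  column-isIntervalTiling : ∀ y → IsIntervalTiling (q zero) (Column q T y)
  column-isIntervalTiling y = record { cover = column-cover ; unique = λ {t} {t'} {x} → column-unique {t} {t'} {x} }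
    where
    column-cover : ∀ x → ∃[ t ] Column q T y t × InInterval (q zero) t x
    column-cover x with cover (x ∷ y)
    ... | t ∷ a , Ta , box with inBox-∷⁻ box
    ...   | x∈t+[q₀] , y∈a+Λ = t , (a , Ta , y∈a+Λ) , x∈t+[q₀]
    column-unique : ∀ {t t' x} → Column q T y t → Column q T y t'
                  → InInterval (q zero) t x → InInterval (q zero) t' x → t ≡ t' [mod q zero ^ 2 ]
    column-unique {x = x} (a , Ta , y∈a+Λ) (a' , Ta' , y∈a'+Λ) x∈t+[q₀] x∈t'+[q₀] =
      mod²-at (unique {x = x ∷ y} Ta Ta' (inBox-∷⁺ x∈t+[q₀] y∈a+Λ) (inBox-∷⁺ x∈t'+[q₀] y∈a'+Λ)) zero

  module Column y = IntervalTiling (column-isIntervalTiling y)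

  slice-isBoxTiling : (e : Section (q zero)) → IsBoxTiling (q ∘ suc) (Slice q T e)
  slice-isBoxTiling e = record { cover = slice-cover ; unique = λ {a} {a'} {y} → slice-unique {a} {a'} {y} }
    where
    open Section e
    slice-cover : ∀ y → ∃[ a ] Slice q T e a × InBox (q ∘ suc) a y
    slice-cover y with cover (+ 0 ∷ y)
    ... | t₀ ∷ a₀ , Ta₀ , box = via-shift (mod⇒mod²-shift (rep-mod t₀))
      where
      via-shift : ∃[ k ] rep t₀ ≡ t₀ + + k * + q zero [mod q zero ^ 2 ]
                → ∃[ a ] Slice q T e a × InBox (q ∘ suc) a y
      via-shift (k , rep≡t₀+kq) with Column.shift y (a₀ , Ta₀ , proj₂ (inBox-∷⁻ box)) k
      ... | t₁ , (a₁ , Ta₁ , y∈a₁+Λ) , t₁≡t₀+kq =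
        a₁ , (t₁ , ≡rep⇒isRep (mod-trans t₁≡t₀+kq (mod-sym rep≡t₀+kq)) , Ta₁) , y∈a₁+Λ
    slice-unique : ∀ {a a' y} → Slice q T e a → Slice q T e a'
                 → InBox (q ∘ suc) a y → InBox (q ∘ suc) a' y → a ≡ a' [mod² q ∘ suc ]
    slice-unique {a} {a'} {y} (t , t-rep , Ta) (t' , t'-rep , Ta') y∈a+Λ y∈a'+Λ = mod² (mod²-at a≡a' ∘ suc)
      where
      t≡t' : t ≡ t' [mod q zero ^ 2 ]
      t≡t' = isRep-unique t-rep t'-rep (Column.aligned y (a , Ta , y∈a+Λ) (a' , Ta' , y∈a'+Λ))
      a≡a' : t ∷ a ≡ t' ∷ a' [mod² q ]
      a≡a' = unique {x = t ∷ y} Ta Ta' (inBox-∷⁺ (inInterval-zero mod-refl) y∈a+Λ)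
                           (inBox-∷⁺ (inInterval-zero t≡t') y∈a'+Λ)

_∥?_ : ∀ q m → Dec (q ∥ m)
q ∥? m = (q ℕ.∣? ∣ m ∣) ×-dec ¬? ((q ^ 2) ℕ.∣? ∣ m ∣)

¬∥⇒mod² : ∀ {q x y} → ¬ q ∥ (x - y) → x ≡ y [mod q ] → x ≡ y [mod q ^ 2 ]
¬∥⇒mod² {q} {x} {y} q∦x-y x≡y with (q ^ 2) ℕ.∣? ∣ x - y ∣
... | yes q²∣x-y = wrap q²∣x-y
... | no  q²∤x-y = ⊥-elim (q∦x-y (unwrap x≡y , q²∤x-y))

tiles-separated : ∀ {d} {q : Fin d → ℕ} {T : Pt d → Set} → IsBoxTiling q T
                → ∀ {a a'} → T a → T a' → ¬ a ≡ a' [mod² q ] → ∃[ i ] q i ∥ (lookup a i - lookup a' i)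
tiles-separated {zero} _ {[]} {[]} _ _ a≢a' = ⊥-elim (a≢a' (mod² λ ()))
tiles-separated {suc d} {q} tiling {a₀ ∷ a} {a₀' ∷ a'} Ta Ta' a≢a' with q zero ∥? (a₀ - a₀')
... | yes q₀∥a₀-a₀' = zero , q₀∥a₀-a₀'
... | no  q₀∦a₀-a₀' =
  map suc id (tiles-separated (slice-isBoxTiling e) (a₀ , a₀-rep , Ta) (a₀' , a₀'-rep , Ta') a≢a'-tail)
  where
  open BoxTilingStep tiling
  lift : a₀ ≡ a₀' [mod q zero ] → a₀ ≡ a₀' [mod q zero ^ 2 ]
  lift = ¬∥⇒mod² q₀∦a₀-a₀'
  through = section-through a₀ a₀' lift
  e = proj₁ through
  a₀-rep = proj₁ (proj₂ through)
  a₀'-rep = proj₂ (proj₂ through)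
  a≢a'-tail : ¬ a ≡ a' [mod² q ∘ suc ]
  a≢a'-tail a≡a' = a≢a' (mod² λ { zero → lift a₀≡a₀' ; (suc i) → mod²-at a≡a' i })
    where
    nonZero = isBoxTiling⇒nonZero tiling ∘ suc
    a₀≡a₀' : a₀ ≡ a₀' [mod q zero ]
    a₀≡a₀' = Column.aligned a (a , Ta , inBox-zero nonZero mod²-refl) (a' , Ta' , inBox-zero nonZero a≡a')

-- The weights M_i and the map π

prime∣product : ∀ {q} → Prime q → ∀ ns → q ℕ.∣ product ns → Any (q ℕ.∣_) ns
prime∣product q-prime []       q∣1      = ⊥-elim (¬prime[1] (subst Prime (ℕ.∣1⇒≡1 q∣1) q-prime))
prime∣product q-prime (n ∷ ns) q∣n*Πns with euclidsLemma n (product ns) q-prime q∣n*Πns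
... | inj₁ q∣n   = here q∣n
... | inj₂ q∣Πns = there (prime∣product q-prime ns q∣Πns)

prime∣prime⇒≡ : ∀ {q r} → Prime q → Prime r → q ℕ.∣ r → q ≡ r
prime∣prime⇒≡ q-prime r-prime q∣r with prime⇒irreducible r-prime q∣r
... | inj₁ q≡1 = ⊥-elim (¬prime[1] (subst Prime q≡1 q-prime))
... | inj₂ q≡r = q≡r

prime∣^2⇒∣ : ∀ {q n} → Prime q → q ℕ.∣ n ^ 2 → q ℕ.∣ n
prime∣^2⇒∣ {q} {n} q-prime q∣n² with euclidsLemma n (n ℕ.* 1) q-prime q∣n²
... | inj₁ q∣n   = q∣n
... | inj₂ q∣n*1 = subst (q ℕ.∣_) (ℕ.*-identityʳ n) q∣n*1

prime²∣*⇒∣ : ∀ {q m} a → Prime q → ¬ q ℕ.∣ m → q ^ 2 ℕ.∣ a ℕ.* m → q ^ 2 ℕ.∣ a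
prime²∣*⇒∣ {q} {m} a q-prime q∤m q²∣am
  with euclidsLemma a m q-prime (ℕ.∣-trans (ℕ.m∣m*n (q ^ 1)) q²∣am)
... | inj₂ q∣m = ⊥-elim (q∤m q∣m)
... | inj₁ (ℕ.divides c refl) with euclidsLemma c m q-prime q∣cm
  where
  instance _ = prime⇒nonZero q-prime
  q∣cm : q ℕ.∣ c ℕ.* m
  q∣cm = ℕ.*-cancelˡ-∣ q (subst₂ ℕ._∣_ (square q) (regroup c q m) q²∣am)
    where
    square : ∀ q → q ^ 2 ≡ q ℕ.* q
    square q = cong (q ℕ.*_) (ℕ.*-identityʳ q)
    regroup : ∀ c q m → c ℕ.* q ℕ.* m ≡ q ℕ.* (c ℕ.* m)
    regroup = ℕ-solve-∀
...   | inj₂ q∣m = ⊥-elim (q∤m q∣m)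
...   | inj₁ (ℕ.divides c' refl) = ℕ.divides c' (regroup c' q)
  where
  regroup : ∀ c' q → c' ℕ.* q ℕ.* q ≡ c' ℕ.* (q ℕ.* (q ℕ.* 1))
  regroup = ℕ-solve-∀

product-allFin : ∀ {d} (f : Fin d → ℕ) → product (List.map f (List.allFin d)) ≡ ∏ f
product-allFin f = trans (cong product (List.map-tabulate id f)) (product-tabulate f)
  where
  product-tabulate : ∀ {d} (f : Fin d → ℕ) → product (List.tabulate f) ≡ ∏ f
  product-tabulate {zero}  f = refl
  product-tabulate {suc d} f = cong (f zero ℕ.*_) (product-tabulate (f ∘ suc))

∏-^2 : ∀ {d} (f : Fin d → ℕ) → ∏ (λ j → f j ^ 2) ≡ ∏ f ^ 2
∏-^2 {d} f = begin
  ∏ (λ j → f j ℕ.* (f j ℕ.* 1))   ≡⟨ ∏-distrib-* f (λ j → f j ℕ.* 1) ⟩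
  ∏ f ℕ.* ∏ (λ j → f j ℕ.* 1)     ≡⟨ cong (∏ f ℕ.*_) (∏-distrib-* f one) ⟩
  ∏ f ℕ.* (∏ f ℕ.* ∏ one)         ≡⟨ cong (λ u → ∏ f ℕ.* (∏ f ℕ.* u)) (∏-replicate-1 d) ⟩
  ∏ f ℕ.* (∏ f ℕ.* 1)             ∎
  where
  open ≡-Reasoning
  one : Fin d → ℕ
  one _ = 1

Mi-factor : ∀ {d} → (Fin d → ℕ) → Fin d → Fin d → ℕ
Mi-factor p i j = if ⌊ j ≟ i ⌋ then 1 else p j ^ 2

module _ {d} (p : Fin d → ℕ) where

  Mi-factor-≡ : ∀ i → Mi-factor p i i ≡ 1
  Mi-factor-≡ i with i ≟ i
  ... | yes _  = refl
  ... | no i≢i = ⊥-elim (i≢i refl)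

  Mi-factor-≢ : ∀ {i j} → j ≢ i → Mi-factor p i j ≡ p j ^ 2
  Mi-factor-≢ {i} {j} j≢i with j ≟ i
  ... | yes j≡i = ⊥-elim (j≢i j≡i)
  ... | no _    = refl

  p²∣Mi : ∀ {i j} → j ≢ i → p i ^ 2 ℕ.∣ Mi p j
  p²∣Mi {i} {j} j≢i = subst (ℕ._∣ Mi p j) (Mi-factor-≢ (j≢i ∘ sym))
                            (∈⇒∣product (∈-map⁺ (Mi-factor p j) (∈-allFin i)))

  p∤Mi : (∀ i → Prime (p i)) → Injective _≡_ _≡_ p → ∀ i → ¬ p i ℕ.∣ Mi p i
  p∤Mi p-prime p-inj i pᵢ∣Mᵢ
    with satisfied (Any.map⁻ (prime∣product (p-prime i) (List.map (Mi-factor p i) (List.allFin d)) pᵢ∣Mᵢ))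
  ... | j , pᵢ∣factor with j ≟ i
  ...   | yes refl = ¬prime[1] (subst Prime (ℕ.∣1⇒≡1 pᵢ∣factor) (p-prime i))
  ...   | no  j≢i  = j≢i (p-inj (sym (prime∣prime⇒≡ (p-prime i) (p-prime j)
                      (prime∣^2⇒∣ (p-prime i) pᵢ∣factor))))

Mi-cofactor : ∀ {d} (p : Fin d → ℕ) i → Mi p i ℕ.* p i ^ 2 ≡ Mof p
Mi-cofactor {suc d} p i = begin
  Mi p i ℕ.* p i ^ 2                            ≡⟨ cong (ℕ._* p i ^ 2) (product-allFin (Mi-factor p i)) ⟩
  ∏ (Mi-factor p i) ℕ.* p i ^ 2                 ≡⟨ cong (ℕ._* p i ^ 2) (∏-remove {i = i} (Mi-factor p i)) ⟩
  Mi-factor p i i ℕ.* ∏ (removeAt (Mi-factor p i) i) ℕ.* p i ^ 2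
                                                ≡⟨ cong₂ (λ u v → u ℕ.* v ℕ.* p i ^ 2) (Mi-factor-≡ p i)
                                                         (∏-cong (λ j → Mi-factor-≢ p (punchInᵢ≢i i j))) ⟩
  1 ℕ.* ∏ (removeAt square i) ℕ.* p i ^ 2       ≡⟨ rearrange (∏ (removeAt square i)) (p i ^ 2) ⟩
  p i ^ 2 ℕ.* ∏ (removeAt square i)             ≡⟨ ∏-remove {i = i} square ⟨
  ∏ square                                      ≡⟨ ∏-^2 p ⟩
  ∏ p ^ 2                                       ≡⟨ cong (_^ 2) (product-allFin p) ⟨
  Mof p                                         ∎
  where
  open ≡-Reasoning
  square = λ j → p j ^ 2
  rearrange : ∀ a b → 1 ℕ.* a ℕ.* b ≡ b ℕ.* a
  rearrange = ℕ-solve-∀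

sumℤ-tabulate : ∀ {d} (f : Fin d → ℤ) → sumℤ (tabulate f) ≡ sum f
sumℤ-tabulate {zero}  f = refl
sumℤ-tabulate {suc d} f = cong (λ s → f zero + s) (sumℤ-tabulate (f ∘ suc))

sum-difference : ∀ {d} (f g : Fin d → ℤ) → sum f - sum g ≡ sum (λ i → f i - g i)
sum-difference {zero}  f g = refl
sum-difference {suc d} f g =
  trans (regroup (f zero) (sum (f ∘ suc)) (g zero) (sum (g ∘ suc)))
        (cong (λ s → (f zero - g zero) + s) (sum-difference (f ∘ suc) (g ∘ suc)))
  where
  regroup : ∀ a b c d → (a + b) - (c + d) ≡ (a - c) + (b - d)
  regroup = solve-∀

∣-sum : ∀ {d m} (f : Fin d → ℤ) → (∀ i → m ℤˢ.∣ f i) → m ℤˢ.∣ sum f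
∣-sum {zero}  f m∣f = ℤˢ.divides (+ 0) refl
∣-sum {suc d} f m∣f = ℤˢ.∣m∣n⇒∣m+n (m∣f zero) (∣-sum (f ∘ suc) (m∣f ∘ suc))

∣-sum-except : ∀ {d m} (f : Fin d → ℤ) i → (∀ j → j ≢ i → m ℤˢ.∣ f j) → m ℤˢ.∣ sum f → m ℤˢ.∣ f i
∣-sum-except {suc d} {m} f i m∣others m∣sum =
  ℤˢ.∣m+n∣n⇒∣m (subst (m ℤˢ.∣_) (sum-remove f) m∣sum)
               (∣-sum (removeAt f i) (λ j → m∣others (punchIn i j) (punchInᵢ≢i i j)))

module _ {d} (p : Fin d → ℕ) where

  private
    weighted : Pt d → Fin d → ℤ
    weighted x i = lookup x i * + Mi p i

    π≡sum : ∀ x → π p x ≡ sum (weighted x)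
    π≡sum x = sumℤ-tabulate (weighted x)

    p²Mi≡M : ∀ i → + (p i ^ 2) * + Mi p i ≡ + Mof p
    p²Mi≡M i = trans (sym (ℤ.pos-* (p i ^ 2) (Mi p i)))
                     (cong +_ (trans (ℕ.*-comm (p i ^ 2) (Mi p i)) (Mi-cofactor p i)))

  π-difference : ∀ x y → π p x - π p y ≡ sum (λ i → (lookup x i - lookup y i) * + Mi p i)
  π-difference x y = begin
    π p x - π p y                                     ≡⟨ cong₂ _-_ (π≡sum x) (π≡sum y) ⟩
    sum (weighted x) - sum (weighted y)               ≡⟨ sum-difference (weighted x) (weighted y) ⟩
    sum (λ i → weighted x i - weighted y i)           ≡⟨ sum-cong-≗ (λ i → distrib (lookup x i) (lookup y i) _) ⟩
    sum (λ i → (lookup x i - lookup y i) * + Mi p i)  ∎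
    where
    open ≡-Reasoning
    distrib : ∀ a b m → a * m - b * m ≡ (a - b) * m
    distrib = solve-∀

  π-⊕ : ∀ x y → π p (x ⊕ᵥ y) ≡ π p x + π p y
  π-⊕ x y = begin
    π p (x ⊕ᵥ y)                                ≡⟨ π≡sum (x ⊕ᵥ y) ⟩
    sum (weighted (x ⊕ᵥ y))                     ≡⟨ sum-cong-≗ distrib ⟩
    sum (λ i → weighted x i + weighted y i)     ≡⟨ ∑-distrib-+ (weighted x) (weighted y) ⟩
    sum (weighted x) + sum (weighted y)         ≡⟨ cong₂ _+_ (π≡sum x) (π≡sum y) ⟨
    π p x + π p y                               ∎
    where
    open ≡-Reasoning
    distrib : ∀ i → weighted (x ⊕ᵥ y) i ≡ weighted x i + weighted y i
    distrib i = trans (cong (_* + Mi p i) (lookup-zipWith _+_ i x y))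
                      (ℤ.*-distribʳ-+ (+ Mi p i) (lookup x i) (lookup y i))

  mod²⇒π-mod : ∀ {x y} → x ≡ y [mod² p ] → π p x ≡ π p y [mod Mof p ]
  mod²⇒π-mod {x} {y} x≡y = ∣⇒mod (subst (+ Mof p ℤˢ.∣_) (sym (π-difference x y)) (∣-sum term M∣term))
    where
    term : Fin d → ℤ
    term i = (lookup x i - lookup y i) * + Mi p i
    M∣term : ∀ i → + Mof p ℤˢ.∣ term i
    M∣term i = subst (ℤˢ._∣ term i) (p²Mi≡M i) (ℤˢ.*-monoˡ-∣ (+ Mi p i) (mod⇒∣ (mod²-at x≡y i)))

  -- Modulo p_i², every term of π x − π y but the i-th vanishes, and p_i ∤ M_i.
  private
    π-mod⇒mod-p² : (∀ i → Prime (p i)) → Injective _≡_ _≡_ p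
                 → ∀ {x y} → π p x ≡ π p y [mod Mof p ] → ∀ i → lookup x i ≡ lookup y i [mod p i ^ 2 ]
    π-mod⇒mod-p² p-prime p-inj {x} {y} πx≡πy i =
      wrap (prime²∣*⇒∣ ∣ Δ i ∣ (p-prime i) (p∤Mi p p-prime p-inj i)
             (subst (p i ^ 2 ℕ.∣_) (ℤ.abs-* (Δ i) (+ Mi p i)) (ℤˢ.∣⇒∣ᵤ p²∣termᵢ)))
      where
      Δ : Fin d → ℤ
      Δ j = lookup x j - lookup y j
      term : Fin d → ℤ
      term j = Δ j * + Mi p j
      p²∣sum : + (p i ^ 2) ℤˢ.∣ sum term
      p²∣sum = ℤˢ.∣-trans (ℤˢ.divides (+ Mi p i) (sym (trans (ℤ.*-comm (+ Mi p i) (+ (p i ^ 2))) (p²Mi≡M i))))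
                          (subst (+ Mof p ℤˢ.∣_) (π-difference x y) (mod⇒∣ πx≡πy))
      p²∣termᵢ : + (p i ^ 2) ℤˢ.∣ term i
      p²∣termᵢ = ∣-sum-except term i
        (λ j j≢i → ℤˢ.∣n⇒∣m*n (Δ j) (ℤˢ.∣ᵤ⇒∣ (p²∣Mi p j≢i))) p²∣sum

  π-mod⇒mod² : (∀ i → Prime (p i)) → Injective _≡_ _≡_ p
             → ∀ {x y} → π p x ≡ π p y [mod Mof p ] → x ≡ y [mod² p ]
  π-mod⇒mod² p-prime p-inj {x} {y} πx≡πy = mod² (π-mod⇒mod-p² p-prime p-inj {x} {y} πx≡πy)

-- Counting

injective⇒surjective : ∀ {n} (f : Fin n → Fin n) → Injective _≡_ _≡_ f → ∀ y → ∃[ x ] f x ≡ y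
injective⇒surjective {zero}  _ _ ()
injective⇒surjective {suc n} f f-inj y with any? (λ x → f x ≟ y)
... | yes hit  = hit
... | no  miss = ⊥-elim (collision (pigeonhole (ℕ.n<1+n n) (λ x → punchOut (y≢f x))))
  where
  y≢f : ∀ x → y ≢ f x
  y≢f x y≡fx = miss (x , sym y≡fx)
  collision : ¬ ∃₂ λ i j → i Fin.< j × punchOut (y≢f i) ≡ punchOut (y≢f j)
  collision (i , j , i<j , same) = <⇒≢ i<j (f-inj (punchOut-injective (y≢f i) (y≢f j) same))

residue : ∀ m .{{_ : NonZero m}} → ℤ → Fin m
residue m x = Fin.fromℕ< (n%ℕd<d x m)

residue-injective : ∀ m .{{_ : NonZero m}} {x y} → residue m x ≡ residue m y → x ≡ y [mod m ]
residue-injective m {x} {y} same = begin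
  x             ≈⟨ %ℕ-mod x m ⟩
  + (x %ℕ m)    ≡⟨ cong +_ (fromℕ<-injective _ _ (n%ℕd<d x m) (n%ℕd<d y m) same) ⟩
  + (y %ℕ m)    ≈⟨ %ℕ-mod y m ⟨
  y             ∎
  where open ≡-mod-Reasoning m

complete-residues : ∀ {k} .{{_ : NonZero k}} {A : Set} → A ↔ Fin k → (g : A → ℤ)
                  → (∀ {u v} → g u ≡ g v [mod k ] → u ≡ v) → ∀ z → ∃[ u ] z ≡ g u [mod k ]
complete-residues {k} A↔k g g-inj z = from (proj₁ hit) , residue-injective k (sym (proj₂ hit))
  where
  open Inverse A↔k
  f : Fin k → Fin k
  f = residue k ∘ g ∘ from
  f-inj : Injective _≡_ _≡_ f
  f-inj {i} {j} fi≡fj = begin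
    i              ≡⟨ strictlyInverseˡ i ⟨
    to (from i)    ≡⟨ cong to (g-inj (residue-injective k fi≡fj)) ⟩
    to (from j)    ≡⟨ strictlyInverseˡ j ⟩
    j              ∎
    where open ≡-Reasoning
  hit : ∃[ i ] f i ≡ residue k z
  hit = injective⇒surjective f f-inj (residue k z)

digits : ∀ {d} (q : Fin d → ℕ) → Fin (∏ q) → Pt d
digits {zero}  q _ = []
digits {suc d} q u = let j , v = remQuot {q zero} (∏ (q ∘ suc)) u in + Fin.toℕ j ∷ digits (q ∘ suc) v

digits-∈Λ : ∀ {d} (q : Fin d → ℕ) u → InΛN q (digits q u)
digits-∈Λ {suc d} q u zero    = +≤+ z≤n , +<+ (toℕ<n (proj₁ (remQuot {q zero} (∏ (q ∘ suc)) u)))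
digits-∈Λ {suc d} q u (suc i) = digits-∈Λ (q ∘ suc) (proj₂ (remQuot {q zero} (∏ (q ∘ suc)) u)) i

digits-injective : ∀ {d} (q : Fin d → ℕ) → Injective _≡_ _≡_ (digits q)
digits-injective {zero}  q {zero} {zero} _ = refl
digits-injective {suc d} q {u} {v} same = begin
  u                            ≡⟨ combine-remQuot {q zero} (∏ (q ∘ suc)) u ⟨
  uncurry combine (split u)    ≡⟨ cong (uncurry combine) (cong₂ _,_ same-head same-tail) ⟩
  uncurry combine (split v)    ≡⟨ combine-remQuot {q zero} (∏ (q ∘ suc)) v ⟩
  v                            ∎
  where
  open ≡-Reasoning
  split = remQuot {q zero} (∏ (q ∘ suc))
  same-head : proj₁ (split u) ≡ proj₁ (split v)
  same-head = toℕ-injective (ℤ.+-injective (∷-injectiveˡ same))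
  same-tail : proj₂ (split u) ≡ proj₂ (split v)
  same-tail = digits-injective (q ∘ suc) (∷-injectiveʳ same)

-- Packings, coverings and tilings

∥⇒disjoint : ∀ {q A A' B B'} → q ∥ (A - A')
           → + 0 ℤ.≤ B × B ℤ.< + q → + 0 ℤ.≤ B' × B' ℤ.< + q
           → ¬ A + B ≡ A' + B' [mod q ^ 2 ]
∥⇒disjoint {q} {A} {A'} {B} {B'} (q∣A-A' , q²∤A-A') (0≤B , B<q) (0≤B' , B'<q) A+B≡A'+B' =
  q²∤A-A' (unwrap (+-cancelʳ-mod B {A} {A'}
    (mod-trans A+B≡A'+B' (+-congˡ-mod A' (mod-reflexive (sym B≡B'))))))
  where
  B≡B' : B ≡ B'
  B≡B' = residue-unique 0≤B B<q 0≤B' B'<q (+-cancelˡ-mod A (begin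
    A + B      ≈⟨ mod²⇒mod A+B≡A'+B' ⟩
    A' + B'    ≈⟨ +-congʳ-mod B' (wrap {A} {A'} q∣A-A') ⟨
    A + B'     ∎))
    where open ≡-mod-Reasoning q

-- In the notation of the paper: Packing says that the sum S ⊕ Λ_N ⊕ 𝓛_M is direct, Covering
-- that S + Λ_N + 𝓛_M = ℤ^d, and CoveringM that π(S) + B = ℤ_M.
module _ {d n} (p : Fin d → ℕ) (s : Fin n → Pt d) where

  Packing : Set
  Packing = ∀ a b a' b' → a ∈S s → InΛN p b → a' ∈S s → InΛN p b'
          → a ⊕ᵥ b ≡ a' ⊕ᵥ b' [mod² p ] → a ≡ a' × b ≡ b'

  Covering : Set
  Covering = ∀ x → ∃[ a ] a ∈S s × InBox p a x

  CoveringM : Set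
  CoveringM = ∀ z → ∃[ a ] ∃[ b ] a ∈S s × InΛN p b × z ≡ π p (a ⊕ᵥ b) [mod Mof p ]

module _ {d n} {p : Fin d → ℕ} {s : Fin n → Pt d} where

  private
    lookup-⊕ᵥ-mod : ∀ {a b a' b'} → a ⊕ᵥ b ≡ a' ⊕ᵥ b' [mod² p ]
                  → ∀ i → lookup a i + lookup b i ≡ lookup a' i + lookup b' i [mod p i ^ 2 ]
    lookup-⊕ᵥ-mod {a} {b} {a'} {b'} a+b≡a'+b' i =
      subst₂ _≡_[mod p i ^ 2 ] (lookup-zipWith _+_ i a b) (lookup-zipWith _+_ i a' b') (mod²-at a+b≡a'+b' i)

  separated⇒packing : Separated p s → Packing p s
  separated⇒packing separated _ b _ b' (k , refl) b∈Λ (k' , refl) b'∈Λ a+b≡a'+b'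
    with ≡-dec ℤ._≟_ (s k) (s k')
  ... | yes sk≡sk' = sk≡sk' , vec-residue-unique b∈Λ b'∈Λ (λ i → mod²⇒mod (+-cancelˡ-mod (lookup (s k) i)
          (mod-trans (lookup-⊕ᵥ-mod a+b≡a'+b' i)
                     (mod-reflexive (cong (λ v → lookup v i + lookup b' i) (sym sk≡sk'))))))
  ... | no  sk≢sk' = ⊥-elim (∥⇒disjoint {A = lookup (s k) i} {lookup (s k') i} pᵢ∥ (b∈Λ i) (b'∈Λ i)
                                         (lookup-⊕ᵥ-mod a+b≡a'+b' i))
    where
    i = proj₁ (separated k k' sk≢sk')
    pᵢ∥ = proj₂ (separated k k' sk≢sk')

  packing×covering⇒isBoxTiling : Packing p s → Covering p s → IsBoxTiling p (_∈S s)
  packing×covering⇒isBoxTiling packing covering =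
    record { cover = covering ; unique = λ {a} {a'} {x} → unique {a} {a'} {x} }
    where
    unique : ∀ {a a' x} → a ∈S s → a' ∈S s → InBox p a x → InBox p a' x → a ≡ a' [mod² p ]
    unique {a} {a'} a∈S a'∈S (b , b∈Λ , x≡a+b) (b' , b'∈Λ , x≡a'+b') =
      mod²-reflexive (proj₁ (packing a b a' b' a∈S b∈Λ a'∈S b'∈Λ (mod²-trans (mod²-sym x≡a+b) x≡a'+b')))

  packing×covering⇒separated : (∀ k → InΛM p (s k)) → Packing p s → Covering p s → Separated p s
  packing×covering⇒separated s∈ΛM packing covering k k' sk≢sk' =
    tiles-separated (packing×covering⇒isBoxTiling packing covering) (k , refl) (k' , refl)
           (sk≢sk' ∘ vec-residue-unique (s∈ΛM k) (s∈ΛM k') ∘ mod²-at)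

  tilesZd⇒packing : TilesZd p s → Packing p s
  tilesZd⇒packing (_ , unique) a b a' b' a∈S b∈Λ a'∈S b'∈Λ a+b≡a'+b' =
    let a≡a' , b≡b' , _ = unique a b 0ᵥ a' b' c' a∈S b∈Λ 0∈L a'∈S b'∈Λ (mod²⇒⊖ᵥ∈L a+b≡a'+b') same
    in  a≡a' , b≡b'
    where
    0ᵥ = replicate d (+ 0)
    c' = (a ⊕ᵥ b) ⊖ᵥ (a' ⊕ᵥ b')
    0∈L : InLM p 0ᵥ
    0∈L i = subst (+ (p i ^ 2) ∣_) (sym (lookup-replicate i (+ 0))) ((p i ^ 2) ℕ.∣0)
    same : a ⊕ᵥ (b ⊕ᵥ 0ᵥ) ≡ a' ⊕ᵥ (b' ⊕ᵥ c')
    same = begin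
      a ⊕ᵥ (b ⊕ᵥ 0ᵥ)           ≡⟨ cong (a ⊕ᵥ_) (⊕ᵥ-identityʳ b) ⟩
      a ⊕ᵥ b                   ≡⟨ ⊕ᵥ-⊖ᵥ (a ⊕ᵥ b) (a' ⊕ᵥ b') ⟨
      (a' ⊕ᵥ b') ⊕ᵥ c'         ≡⟨ ⊕ᵥ-assoc a' b' c' ⟩
      a' ⊕ᵥ (b' ⊕ᵥ c')         ∎
      where open ≡-Reasoning

  packing×covering⇒tilesZd : Packing p s → Covering p s → TilesZd p s
  packing×covering⇒tilesZd packing covering = cover , unique
    where
    cover : ∀ z → ∃[ a ] ∃[ b ] ∃[ c ] (a ∈S s × InΛN p b × InLM p c × z ≡ a ⊕ᵥ (b ⊕ᵥ c))
    cover z =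
      let a , a∈S , b , b∈Λ , z≡a+b = covering z
      in  a , b , z ⊖ᵥ (a ⊕ᵥ b) , a∈S , b∈Λ , mod²⇒⊖ᵥ∈L z≡a+b ,
          trans (sym (⊕ᵥ-⊖ᵥ z (a ⊕ᵥ b))) (⊕ᵥ-assoc a b (z ⊖ᵥ (a ⊕ᵥ b)))
    unique : ∀ a b c a' b' c' → a ∈S s → InΛN p b → InLM p c → a' ∈S s → InΛN p b' → InLM p c'
           → a ⊕ᵥ (b ⊕ᵥ c) ≡ a' ⊕ᵥ (b' ⊕ᵥ c') → (a ≡ a') × (b ≡ b') × (c ≡ c')
    unique a b c a' b' c' a∈S b∈Λ c∈L a'∈S b'∈Λ c'∈L same = a≡a' , b≡b' , c≡c'
      where
      a+b≡a'+b' : a ⊕ᵥ b ≡ a' ⊕ᵥ b' [mod² p ]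
      a+b≡a'+b' = mod²-trans (mod²-sym (∈L⇒⊕ᵥ-mod² c∈L (a ⊕ᵥ b)))
                   (subst (_≡ a' ⊕ᵥ b' [mod² p ]) (sym regrouped) (∈L⇒⊕ᵥ-mod² c'∈L (a' ⊕ᵥ b')))
        where
        regrouped : (a ⊕ᵥ b) ⊕ᵥ c ≡ (a' ⊕ᵥ b') ⊕ᵥ c'
        regrouped = trans (⊕ᵥ-assoc a b c) (trans same (sym (⊕ᵥ-assoc a' b' c')))
      a≡a' = proj₁ (packing a b a' b' a∈S b∈Λ a'∈S b'∈Λ a+b≡a'+b')
      b≡b' = proj₂ (packing a b a' b' a∈S b∈Λ a'∈S b'∈Λ a+b≡a'+b')
      c≡c' : c ≡ c'
      c≡c' = ⊕ᵥ-cancelˡ b (⊕ᵥ-cancelˡ a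
               (trans same (cong₂ (λ u v → u ⊕ᵥ (v ⊕ᵥ c')) (sym a≡a') (sym b≡b'))))

module _ {d} {p : Fin d → ℕ} (p-prime : ∀ i → Prime (p i)) (p-inj : Injective _≡_ _≡_ p) where

  instance
    _ : NonZero (Mof p)
    _ = ℕ.m^n≢0 (Nof p) 2 {{productOfPrimes≢0 (All.map⁺ (All.tabulate⁺ p-prime))}}

  -- |S × Λ_N| = N · N = M, so an injective π on S × Λ_N hits every residue modulo M.
  packing⇒coveringM : {s : Fin (Nof p) → Pt d} → Injective _≡_ _≡_ s → Packing p s → CoveringM p s
  packing⇒coveringM {s} s-inj packing z =
    let (k , u) , z≡gku = complete-residues index↔ g g-inj z
    in  s k , digits p u , (k , refl) , digits-∈Λ p u , z≡gku
    where
    g : Fin (Nof p) × Fin (∏ p) → ℤ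
    g (k , u) = π p (s k ⊕ᵥ digits p u)
    g-inj : ∀ {v w} → g v ≡ g w [mod Mof p ] → v ≡ w
    g-inj {k , u} {k' , u'} gv≡gw =
      let sk≡sk' , du≡du' = packing (s k) (digits p u) (s k') (digits p u') (k , refl) (digits-∈Λ p u)
                                    (k' , refl) (digits-∈Λ p u') (π-mod⇒mod² p p-prime p-inj gv≡gw)
      in  cong₂ _,_ (s-inj sk≡sk') (digits-injective p du≡du')
    size : Nof p ℕ.* ∏ p ≡ Mof p
    size = cong (Nof p ℕ.*_) (trans (sym (product-allFin p)) (sym (ℕ.*-identityʳ (Nof p))))
    index↔ : (Fin (Nof p) × Fin (∏ p)) ↔ Fin (Mof p)
    index↔ = subst (λ m → (Fin (Nof p) × Fin (∏ p)) ↔ Fin m) size (↔-sym *↔×)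

  coveringM⇒covering : ∀ {n} {s : Fin n → Pt d} → CoveringM p s → Covering p s
  coveringM⇒covering coveringM x =
    let a , b , a∈S , b∈Λ , πx≡πa+b = coveringM (π p x)
    in  a , a∈S , b , b∈Λ , π-mod⇒mod² p p-prime p-inj {x} {a ⊕ᵥ b} πx≡πa+b

  tilesZM⇒packing : ∀ {n} {s : Fin n → Pt d} → (∀ k → InΛM p (s k)) → TilesZM p s → Packing p s
  tilesZM⇒packing {s = s} s∈ΛM (_ , unique) a b a' b' a∈S@(k , refl) b∈Λ a'∈S@(k' , refl) b'∈Λ a+b≡a'+b' =
    let πa≡πa' , πb≡πb' = unique a b a' b' a∈S b∈Λ a'∈S b'∈Λ (unwrap πa+πb≡πa'+πb')
    in  vec-residue-unique (s∈ΛM k) (s∈ΛM k') (mod²-at (π-mod⇒mod² p p-prime p-inj {a} {a'} (wrap πa≡πa'))) ,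
        vec-residue-unique b∈Λ b'∈Λ (mod²⇒mod ∘ mod²-at (π-mod⇒mod² p p-prime p-inj {b} {b'} (wrap πb≡πb')))
    where
    πa+πb≡πa'+πb' : π p a + π p b ≡ π p a' + π p b' [mod Mof p ]
    πa+πb≡πa'+πb' = subst₂ _≡_[mod Mof p ] (π-⊕ p a b) (π-⊕ p a' b') (mod²⇒π-mod p a+b≡a'+b')

  packing×coveringM⇒tilesZM : ∀ {n} {s : Fin n → Pt d} → Packing p s → CoveringM p s → TilesZM p s
  packing×coveringM⇒tilesZM {s = s} packing coveringM = cover , unique
    where
    cover : ∀ z → ∃[ a ] ∃[ b ] (a ∈S s × InΛN p b × z ≡[mod Mof p ] (π p a + π p b))
    cover z =
      let a , b , a∈S , b∈Λ , z≡π[a+b] = coveringM z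
      in  a , b , a∈S , b∈Λ , unwrap (mod-trans z≡π[a+b] (mod-reflexive (π-⊕ p a b)))
    unique : ∀ a b a' b' → a ∈S s → InΛN p b → a' ∈S s → InΛN p b'
           → (π p a + π p b) ≡[mod Mof p ] (π p a' + π p b')
           → (π p a ≡[mod Mof p ] π p a') × (π p b ≡[mod Mof p ] π p b')
    unique a b a' b' a∈S b∈Λ a'∈S b'∈Λ πa+πb≡πa'+πb' =
      let a≡a' , b≡b' = packing a b a' b' a∈S b∈Λ a'∈S b'∈Λ
                          (π-mod⇒mod² p p-prime p-inj {a ⊕ᵥ b} {a' ⊕ᵥ b'} π[a+b]≡π[a'+b'])
      in  unwrap (mod-reflexive (cong (π p) a≡a')) , unwrap (mod-reflexive (cong (π p) b≡b'))
      where
      π[a+b]≡π[a'+b'] : π p (a ⊕ᵥ b) ≡ π p (a' ⊕ᵥ b') [mod Mof p ]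
      π[a+b]≡π[a'+b'] = subst₂ _≡_[mod Mof p ] (sym (π-⊕ p a b)) (sym (π-⊕ p a' b')) (wrap πa+πb≡πa'+πb')

lemma2p4 : (d : ℕ) (p : Fin d → ℕ) → (∀ i → Prime (p i)) → Injective _≡_ _≡_ p
    → (s : Fin (Nof p) → Pt d) → Injective _≡_ _≡_ s → (∀ k → InΛM p (s k))
    → (TilesZd p s ⇔ Separated p s) × (TilesZM p s ⇔ Separated p s)
lemma2p4 d p p-prime p-inj s s-inj s∈ΛM =
  ⇔-trans tilesZd⇔packing packing⇔separated , ⇔-trans tilesZM⇔packing packing⇔separated
  where
  coveringM : Packing p s → CoveringM p s
  coveringM = packing⇒coveringM p-prime p-inj s-inj
  covering : Packing p s → Covering p s
  covering = coveringM⇒covering p-prime p-inj ∘ coveringM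
  packing⇔separated : Packing p s ⇔ Separated p s
  packing⇔separated = mk⇔ (λ P → packing×covering⇒separated s∈ΛM P (covering P)) separated⇒packing
  tilesZd⇔packing : TilesZd p s ⇔ Packing p s
  tilesZd⇔packing = mk⇔ tilesZd⇒packing (λ P → packing×covering⇒tilesZd P (covering P))
  tilesZM⇔packing : TilesZM p s ⇔ Packing p s
  tilesZM⇔packing = mk⇔ (tilesZM⇒packing p-prime p-inj s∈ΛM)
                        (λ P → packing×coveringM⇒tilesZM p-prime p-inj P (coveringM P))
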